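{- The game $\langle P_{2s}, h, g\rangle$, where $h$ is the function constantly equal to $4s-2$ and $g$ is the function constantly equal to $s$, is winning.
   Context: Hat guessing game $\langle G, h, g\rangle$: a sage sits at each vertex $v$ of the graph $G$; an adversary puts on the head of each sage $v$ a hat whose color is chosen from $\{0,1,\dots,h(v)-1\}$; each sage sees the hat colors of his neighbours but not his own; without communication, each sage $v$ names a list of $g(v)$ colors, determined by a deterministic strategy (fixed in advance and known to the adversary) from the colors he sees. The game is winning if there is a strategy guaranteeing that for every hat assignment at least one sage's list contains his own hat color. $P_{2s}$ is the path on $2s$ vertices, $s\ge 1$ an integer. -}

module Defs where

open import Data.Nat using (ℕ; suc)
open import Data.Nat.Properties using (1+n≢n)
open import Data.Fin using (Fin; toℕ)
open import Data.Vec using (Vec)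
open import Data.Vec.Membership.Propositional using (_∈_)
open import Data.Product using (Σ; ∃; _×_)
open import Data.Sum using (_⊎_; inj₁; inj₂)
open import Data.Empty using (⊥)
open import Relation.Binary.PropositionalEquality using (_≡_)

record Graph (n : ℕ) : Set₁ where
  field
    Adj    : Fin n → Fin n → Set
    Adj-sym    : ∀ {u v} → Adj u v → Adj v u
    Adj-irrefl : ∀ {v} → Adj v v → ⊥
open Graph public

PathAdj : {m : ℕ} → Fin m → Fin m → Set
PathAdj i j = (suc (toℕ i) ≡ toℕ j) ⊎ (suc (toℕ j) ≡ toℕ i)

path : (m : ℕ) → Graph m
path m = record
  { Adj        = PathAdj
  ; Adj-sym    = λ { (inj₁ p) → inj₂ p ; (inj₂ p) → inj₁ p }
  ; Adj-irrefl = λ { {v} (inj₁ p) → 1+n≢n p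
                   ; {v} (inj₂ p) → 1+n≢n p }
  }

HatAssignment : {n : ℕ} → (h : Fin n → ℕ) → Set
HatAssignment {n} h = (v : Fin n) → Fin (h v)

record Strategy {n : ℕ} (G : Graph n) (h g : Fin n → ℕ) : Set where
  field
    guess : (v : Fin n) → HatAssignment h → Vec (Fin (h v)) (g v)
    local : (v : Fin n) (c c′ : HatAssignment h) →
            (∀ u → Adj G v u → c u ≡ c′ u) → guess v c ≡ guess v c′
open Strategy public

Wins : {n : ℕ} {G : Graph n} {h g : Fin n → ℕ} → Strategy G h g → Set
Wins {h = h} σ = (c : HatAssignment h) → ∃ λ v → c v ∈ guess σ v c

Winning : {n : ℕ} → Graph n → (h g : Fin n → ℕ) → Set
Winning G h g = Σ (Strategy G h g) Wins

-- Put s = n + 2 and m = 2s − 1; a colour is a layer (a Bool) together with a residue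
-- modulo m, which gives the 2m = 4s − 2 colours. Each half of the path is numbered
-- 0, …, s − 1 from its end towards the middle, and along it the relations Near j, unions
-- of two windows of residues, are propagated: if sages 0, …, i of a half all guess wrong,
-- then the colours of sages i and i + 1 are not Near (i + 1). Sage j > 0, seeing z and y,
-- has to name the colours x with Near (j + 1) x y but not Near j z x; of the j + s colours
-- x with Near (j + 1) x y at least j are Near j z (they fill two runs whose lengths add
-- up to j), so s guesses suffice. Each middle sage then knows that its colour is not
-- Near (s − 1) to its outer neighbour, which leaves s residues in every layer; the left one
-- names those in the layer of its right neighbour, the right one those in the other layer
-- than its left neighbour's, so they cannot both be wrong. The path on two vertices is the
-- classical game in which one sage bets on equal and the other on different colours.
module Submission where

open import Defs
open import Data.Bool using (Bool; true; false; not; _xor_)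
open import Data.Bool.Properties using (¬-not)
open import Data.Fin using (Fin; toℕ; fromℕ<; splitAt; join; cast; opposite) renaming (zero to fzero)
open import Data.Fin.Patterns using (0F; 1F)
open import Data.Fin.Properties using (toℕ-fromℕ<; toℕ-injective; toℕ<n; join-splitAt; cast-involutive; any?)
import Data.Fin.Properties as Fin
open import Data.List using (List; []; _∷_; _++_; length; filter; map; applyDownFrom)
open import Data.List.Membership.Propositional using (_∈_; _∉_)
open import Data.List.Membership.Propositional.Properties using (∈-++⁺ˡ; ∈-++⁺ʳ; ∈-applyDownFrom⁺; ∈-filter⁺; ∈-map⁺)
open import Data.List.Properties using (filter-reject; filter-++; length-filter; length-++; length-map; length-applyDownFrom)
open import Data.List.Relation.Unary.Any using (here; there)
open import Data.Nat
open import Data.Nat.DivMod using (_%_; _mod_; m%n%n≡m%n; %-distribˡ-+; [m+kn]%n≡m%n; m<n⇒m%n≡m; m%n<n; m≤n⇒[n∸m]%m≡n%m)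
open import Data.Nat.Properties
open import Algebra.Properties.CommutativeSemigroup +-commutativeSemigroup using (interchange)
open import Data.Nat.Tactic.RingSolver using (solve-∀)
open import Data.Product using (∃; _×_; _,_; proj₁; proj₂)
open import Data.Sum using (_⊎_; inj₁; inj₂; [_,_]′)
open import Data.Vec using (Vec; replicate) renaming (_∷_ to _∷ᵥ_; [] to []ᵥ)
import Data.Vec.Membership.Propositional as Vec
import Data.Vec.Relation.Unary.Any as VecAny
open import Function using (_∘_)
open import Relation.Binary.Bundles using (Setoid)
open import Relation.Binary.PropositionalEquality
import Relation.Binary.Reasoning.Setoid
open import Relation.Nullary using (¬_; Dec; ¬?; yes; no; contradiction)
open import Relation.Nullary.Decidable using (decidable-stable)
open import Relation.Unary using (Pred; Decidable)

infix 4 _≡_[mod_]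
record _≡_[mod_] (a b m : ℕ) .{{_ : NonZero m}} : Set where
  constructor mod-≡
  field %-≡ : a % m ≡ b % m

module _ {m : ℕ} .{{_ : NonZero m}} where

  ≡[mod]-refl : ∀ {a} → a ≡ a [mod m ]
  ≡[mod]-refl = mod-≡ refl

  ≡[mod]-sym : ∀ {a b} → a ≡ b [mod m ] → b ≡ a [mod m ]
  ≡[mod]-sym (mod-≡ e) = mod-≡ (sym e)

  ≡[mod]-trans : ∀ {a b c} → a ≡ b [mod m ] → b ≡ c [mod m ] → a ≡ c [mod m ]
  ≡[mod]-trans (mod-≡ e) (mod-≡ f) = mod-≡ (trans e f)

  ≡[mod]-setoid : Setoid _ _
  ≡[mod]-setoid = record
    { _≈_ = _≡_[mod m ]
    ; isEquivalence = record { refl = ≡[mod]-refl ; sym = ≡[mod]-sym ; trans = ≡[mod]-trans }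
    }

  module ≡[mod]-Reasoning = Relation.Binary.Reasoning.Setoid ≡[mod]-setoid

  ≡⇒≡[mod] : ∀ {a b} → a ≡ b → a ≡ b [mod m ]
  ≡⇒≡[mod] refl = ≡[mod]-refl

  %-≡[mod] : ∀ a → a % m ≡ a [mod m ]
  %-≡[mod] a = mod-≡ (m%n%n≡m%n a m)

  +-cong-≡[mod] : ∀ {a b c d} → a ≡ b [mod m ] → c ≡ d [mod m ] → a + c ≡ b + d [mod m ]
  +-cong-≡[mod] {a} {b} {c} {d} (mod-≡ a≡b) (mod-≡ c≡d) = mod-≡ (begin
    (a + c) % m           ≡⟨ %-distribˡ-+ a c m ⟩
    (a % m + c % m) % m   ≡⟨ cong₂ (λ x y → (x + y) % m) a≡b c≡d ⟩
    (b % m + d % m) % m   ≡⟨ %-distribˡ-+ b d m ⟨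
    (b + d) % m           ∎)
    where open ≡-Reasoning

  +-multiple-≡[mod] : ∀ a k → a + k * m ≡ a [mod m ]
  +-multiple-≡[mod] a k = mod-≡ ([m+kn]%n≡m%n a k m)

  ≡[mod]⇒≡ : ∀ {a b} → a < m → b < m → a ≡ b [mod m ] → a ≡ b
  ≡[mod]⇒≡ {a} {b} a<m b<m (mod-≡ a≡b) = begin
    a      ≡⟨ m<n⇒m%n≡m a<m ⟨
    a % m  ≡⟨ a≡b ⟩
    b % m  ≡⟨ m<n⇒m%n≡m b<m ⟩
    b      ∎
    where open ≡-Reasoning

  toℕ-mod : ∀ a → toℕ (a mod m) ≡ a % m
  toℕ-mod a = toℕ-fromℕ< (m%n<n a m)

module _ {n : ℕ} where

  infixl 6 _⊖_
  _⊖_ : Fin (suc n) → ℕ → Fin (suc n)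
  a ⊖ k = (toℕ a + n * k) mod suc n

  ⊖-+-≡[mod] : ∀ a k → toℕ (a ⊖ k) + k ≡ toℕ a [mod suc n ]
  ⊖-+-≡[mod] a k = begin
    toℕ (a ⊖ k) + k       ≈⟨ +-cong-≡[mod] (≡[mod]-trans (≡⇒≡[mod] (toℕ-mod x)) (%-≡[mod] x)) ≡[mod]-refl ⟩
    toℕ a + n * k + k     ≡⟨ +-assoc (toℕ a) (n * k) k ⟩
    toℕ a + (n * k + k)   ≡⟨ cong (toℕ a +_) (trans (+-comm (n * k) k) (*-comm (suc n) k)) ⟩
    toℕ a + k * suc n     ≈⟨ +-multiple-≡[mod] (toℕ a) k ⟩
    toℕ a                 ∎
    where
      open ≡[mod]-Reasoning
      x = toℕ a + n * k

  +-cancelʳ-≡[mod] : ∀ {a b} k → a + k ≡ b + k [mod suc n ] → a ≡ b [mod suc n ]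
  +-cancelʳ-≡[mod] {a} {b} k a+k≡b+k = begin
    a                   ≈⟨ +-multiple-≡[mod] a k ⟨
    a + k * suc n       ≡⟨ regroup a ⟩
    a + k + n * k       ≈⟨ +-cong-≡[mod] a+k≡b+k ≡[mod]-refl ⟩
    b + k + n * k       ≡⟨ regroup b ⟨
    b + k * suc n       ≈⟨ +-multiple-≡[mod] b k ⟩
    b                   ∎
    where
      open ≡[mod]-Reasoning
      regroup : ∀ x → x + k * suc n ≡ x + k + n * k
      regroup x = trans (cong (x +_) (*-comm k (suc n))) (sym (+-assoc x k (n * k)))

  ⊖-unique : ∀ {a k c} → c < suc n → c + k ≡ toℕ a [mod suc n ] → toℕ (a ⊖ k) ≡ c
  ⊖-unique {a} {k} c<m c+k≡a = ≡[mod]⇒≡ (toℕ<n (a ⊖ k)) c<m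
    (+-cancelʳ-≡[mod] k (≡[mod]-trans (⊖-+-≡[mod] a k) (≡[mod]-sym c+k≡a)))

  ⊖-exact : ∀ {a k e} → k + e ≡ toℕ a → toℕ (a ⊖ k) ≡ e
  ⊖-exact {a} {k} {e} k+e≡a = ⊖-unique (≤-<-trans (m≤n+m e k) (subst (_< suc n) (sym k+e≡a) (toℕ<n a)))
    (≡⇒≡[mod] (trans (+-comm e k) k+e≡a))

  ⊖-⊖ : ∀ a k l → a ⊖ k ⊖ l ≡ a ⊖ (k + l)
  ⊖-⊖ a k l = toℕ-injective (⊖-unique (toℕ<n (a ⊖ (k + l))) (+-cancelʳ-≡[mod] k (begin
    toℕ (a ⊖ (k + l)) + l + k    ≡⟨ +-assoc (toℕ (a ⊖ (k + l))) l k ⟩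
    toℕ (a ⊖ (k + l)) + (l + k)  ≡⟨ cong (toℕ (a ⊖ (k + l)) +_) (+-comm l k) ⟩
    toℕ (a ⊖ (k + l)) + (k + l)  ≈⟨ ⊖-+-≡[mod] a (k + l) ⟩
    toℕ a                        ≈⟨ ⊖-+-≡[mod] a k ⟨
    toℕ (a ⊖ k) + k              ∎)))
    where open ≡[mod]-Reasoning

  ⊖-cong : ∀ a {k l} → k ≡ l [mod suc n ] → a ⊖ k ≡ a ⊖ l
  ⊖-cong a {k} {l} k≡l = toℕ-injective (⊖-unique (toℕ<n (a ⊖ l))
    (≡[mod]-trans (+-cong-≡[mod] ≡[mod]-refl k≡l) (⊖-+-≡[mod] a l)))

  toℕ-⊖-cases : ∀ a {k} → k ≤ suc n → toℕ (a ⊖ k) + k ≡ toℕ a ⊎ toℕ (a ⊖ k) + k ≡ toℕ a + suc n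
  toℕ-⊖-cases a {k} k≤m with toℕ (a ⊖ k) + k <? suc n
  ... | yes r+k<m = inj₁ (≡[mod]⇒≡ r+k<m (toℕ<n a) (⊖-+-≡[mod] a k))
  ... | no r+k≮m = inj₂ (begin
    r + k                   ≡⟨ m∸n+n≡m m≤r+k ⟨
    r + k ∸ suc n + suc n   ≡⟨ cong (_+ suc n) (≡[mod]⇒≡ wrapped<m (toℕ<n a) wrapped≡a) ⟩
    toℕ a + suc n           ∎)
    where
      open ≡-Reasoning
      r = toℕ (a ⊖ k)
      m≤r+k = ≮⇒≥ r+k≮m
      wrapped<m : r + k ∸ suc n < suc n
      wrapped<m = m<n+o⇒m∸n<o (r + k) (suc n) (+-mono-<-≤ (toℕ<n (a ⊖ k)) k≤m)
      wrapped≡a : r + k ∸ suc n ≡ toℕ a [mod suc n ]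
      wrapped≡a = ≡[mod]-trans (mod-≡ (m≤n⇒[n∸m]%m≡n%m m≤r+k)) (⊖-+-≡[mod] a k)

  mod-⊖ : ∀ c {t} → t < suc n → toℕ ((c + t) mod suc n ⊖ c) ≡ t
  mod-⊖ c {t} t<m = ⊖-unique t<m (≡[mod]-trans (≡⇒≡[mod] (+-comm t c))
    (≡[mod]-trans (≡[mod]-sym (%-≡[mod] (c + t))) (≡⇒≡[mod] (sym (toℕ-mod (c + t))))))

  ⊖-mod : ∀ x c → (c + toℕ (x ⊖ c)) mod suc n ≡ x
  ⊖-mod x c = toℕ-injective (≡[mod]⇒≡ (toℕ<n _) (toℕ<n x) (begin
    toℕ ((c + r) mod suc n)   ≡⟨ toℕ-mod (c + r) ⟩
    (c + r) % suc n           ≈⟨ %-≡[mod] (c + r) ⟩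
    c + r                     ≡⟨ +-comm c r ⟩
    r + c                     ≈⟨ ⊖-+-≡[mod] x c ⟩
    toℕ x                     ∎))
    where
      open ≡[mod]-Reasoning
      r = toℕ (x ⊖ c)

module _ {a p} {A : Set a} {P : Pred A p} (P? : Decidable P) where

  length-filter-∷ : ∀ x xs → length (filter P? (x ∷ xs)) ≤ suc (length (filter P? xs))
  length-filter-∷ x xs with P? x
  ... | yes _ = ≤-refl
  ... | no  _ = n≤1+n _

  length-filter-applyDownFrom-gap : ∀ (g : ℕ → A) R {lo w} → lo + w ≤ R →
    (∀ {i} → lo ≤ i → i < lo + w → ¬ P (g i)) →
    length (filter P? (applyDownFrom g R)) + w ≤ R
  length-filter-applyDownFrom-gap g zero {lo} {zero} _ _ = z≤n
  length-filter-applyDownFrom-gap g zero {lo} {suc w} lo+w≤0 _ with () ← ≤-trans (m≤n+m (suc w) lo) lo+w≤0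
  length-filter-applyDownFrom-gap g (suc R) {lo} {w} lo+w≤1+R gap with m≤n⇒m<n∨m≡n lo+w≤1+R
  ... | inj₁ (s≤s lo+w≤R) = begin
    length (filter P? (g R ∷ applyDownFrom g R)) + w    ≤⟨ +-monoˡ-≤ w (length-filter-∷ (g R) (applyDownFrom g R)) ⟩
    suc (length (filter P? (applyDownFrom g R)) + w)    ≤⟨ s≤s (length-filter-applyDownFrom-gap g R lo+w≤R gap) ⟩
    suc R                                               ∎
    where open ≤-Reasoning
  ... | inj₂ lo+w≡1+R with w
  ...   | zero = begin
    length (filter P? (applyDownFrom g (suc R))) + 0    ≡⟨ +-identityʳ _ ⟩
    length (filter P? (applyDownFrom g (suc R)))        ≤⟨ length-filter P? (applyDownFrom g (suc R)) ⟩
    length (applyDownFrom g (suc R))                    ≡⟨ length-applyDownFrom g (suc R) ⟩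
    suc R                                               ∎
    where open ≤-Reasoning
  ...   | suc w′ = begin
    length (filter P? (g R ∷ applyDownFrom g R)) + suc w′  ≡⟨ cong (λ xs → length xs + suc w′) (filter-reject P? (gap lo≤R R<lo+w)) ⟩
    length (filter P? (applyDownFrom g R)) + suc w′        ≡⟨ +-suc _ w′ ⟩
    suc (length (filter P? (applyDownFrom g R)) + w′)      ≤⟨ s≤s (length-filter-applyDownFrom-gap g R (≤-reflexive lo+w′≡R) shorter-gap) ⟩
    suc R                                                  ∎
    where
      open ≤-Reasoning
      lo+w′≡R : lo + w′ ≡ R
      lo+w′≡R = suc-injective (trans (sym (+-suc lo w′)) lo+w≡1+R)
      lo≤R : lo ≤ R
      lo≤R = subst (lo ≤_) lo+w′≡R (m≤m+n lo w′)
      R<lo+w : R < lo + suc w′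
      R<lo+w = ≤-reflexive (sym lo+w≡1+R)
      shorter-gap : ∀ {i} → lo ≤ i → i < lo + w′ → ¬ P (g i)
      shorter-gap lo≤i i<lo+w′ = gap lo≤i (<-≤-trans i<lo+w′ (+-monoʳ-≤ lo (n≤1+n w′)))

record Window (R M v B : ℕ) : Set where
  field
    start : ℕ
    fits  : start + B ≤ R
    near  : ∀ {i} → start ≤ i → i < start + B → ∃ λ e → i + e ≡ v × e < M

empty-window : ∀ {R M v} → Window R M v 0
empty-window = record { start = 0 ; fits = z≤n ; near = λ _ () }

below-within : ∀ {i v M} → i ≤ v → v < i + M → ∃ λ e → i + e ≡ v × e < M
below-within {i} {v} {M} i≤v v<i+M =
  v ∸ i , m+[n∸m]≡n i≤v , +-cancelˡ-< i (v ∸ i) M (subst (_< i + M) (sym (m+[n∸m]≡n i≤v)) v<i+M)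

window : ∀ {R M v B} → B ≤ R → B ≤ M → B ≤ suc v → B + v < R + M → Window R M v B
window {R} {M} {v} {B} B≤R B≤M B≤1+v B+v<R+M with M ≤? suc v
... | no M≰1+v = record
  { start = 0
  ; fits  = B≤R
  ; near  = λ _ i<B → below-within (s≤s⁻¹ (<-≤-trans i<B B≤1+v)) (≤-trans (<⇒≤ (≰⇒> M≰1+v)) (m≤n+m M _))
  }
... | yes M≤1+v = record
  { start = lo
  ; fits  = +-cancelʳ-≤ M (lo + B) R (begin
      lo + B + M    ≡⟨ +-assoc lo B M ⟩
      lo + (B + M)  ≡⟨ cong (lo +_) (+-comm B M) ⟩
      lo + (M + B)  ≡⟨ +-assoc lo M B ⟨
      lo + M + B    ≡⟨ cong (_+ B) lo+M≡1+v ⟩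
      suc v + B     ≡⟨ +-comm (suc v) B ⟩
      B + suc v     ≡⟨ +-suc B v ⟩
      suc (B + v)   ≤⟨ B+v<R+M ⟩
      R + M         ∎)
  ; near  = λ {i} lo≤i i<lo+B → below-within
      (s≤s⁻¹ (<-≤-trans i<lo+B (subst (lo + B ≤_) lo+M≡1+v (+-monoʳ-≤ lo B≤M))))
      (subst (_≤ i + M) lo+M≡1+v (+-monoˡ-≤ M lo≤i))
  }
  where
    open ≤-Reasoning
    lo = suc v ∸ M
    lo+M≡1+v : lo + M ≡ suc v
    lo+M≡1+v = m∸n+n≡m M≤1+v

-- Position i of a path names L i z y, where z and y are the colours at positions i − 1 and
-- i + 1; R i is what the failure of positions 0, …, i rules out.
record ChainCover {C : Set} (n : ℕ) (R : ℕ → C → C → Set) (Q : C → C → Set) (L : ℕ → C → C → List C) : Set where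
  field
    cover-first : ∀ {z x y} → R 0 x y → x ∈ L 0 z y
    cover-step  : ∀ {i z x y} → i < n → R (suc i) x y → ¬ R i z x → x ∈ L (suc i) z y
    cover-last  : ∀ {z x y} → Q x y → ¬ R n z x → x ∈ L (suc n) z y

  module _ (κ : ℕ → C) (miss : ∀ i → i ≤ suc n → κ i ∉ L i (κ (pred i)) (κ (suc i))) where

    excluded : ∀ i → i ≤ n → ¬ R i (κ i) (κ (suc i))
    excluded zero    _     r = miss 0 z≤n (cover-first r)
    excluded (suc i) 1+i≤n r = miss (suc i) (m≤n⇒m≤1+n 1+i≤n) (cover-step 1+i≤n r (excluded i (<⇒≤ 1+i≤n)))

    excluded-last : ¬ Q (κ (suc n)) (κ (suc (suc n)))
    excluded-last q = miss (suc n) ≤-refl (cover-last q (excluded n ≤-refl))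

module Colours (n : ℕ) where

  s m : ℕ
  s = suc (suc n)
  m = suc n + s

  Colour : Set
  Colour = Bool × Fin m

  width : ℕ → Bool → ℕ
  width j false = j
  width j true  = suc n

  -- (j + s) * s is the half of j + s modulo m, as 2s = m + 1; this makes offset-step hold.
  offset : ℕ → Bool → ℕ
  offset j false = 0
  offset j true  = (j + s) * s

  -- The residue of x lies in a window of width j (same layer as z) or s − 1 (other layer),
  -- placed at an offset above the residue of z.
  Near : ℕ → Colour → Colour → Set
  Near j (b , r) (b′ , r′) = toℕ (r′ ⊖ (toℕ r + offset j (b xor b′))) < width j (b xor b′)

  Near? : ∀ j z x → Dec (Near j z x)
  Near? j (b , r) (b′ , r′) = _ <? _

  width-≥ : ∀ {j} ε → j ≤ n → j ≤ width j ε
  width-≥ false j≤n = ≤-refl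
  width-≥ true  j≤n = m≤n⇒m≤1+n j≤n

  width-≤ : ∀ {j} ε → j ≤ n → width j ε ≤ suc n
  width-≤ false j≤n = m≤n⇒m≤1+n j≤n
  width-≤ true  j≤n = ≤-refl

  width-total : ∀ j ε → width j ε + width j (not ε) ≡ j + suc n
  width-total j false = refl
  width-total j true  = +-comm (suc n) j

  width-last : ∀ δ → width (suc n) δ ≡ suc n
  width-last false = refl
  width-last true  = refl

  offset-step : ∀ j ε → offset j ε + suc (width j ε) ≡ offset j (not ε) + offset (suc j) true [mod m ]
  offset-step j false = ≡[mod]-sym (≡[mod]-trans (≡⇒≡[mod] (halve n j)) (+-multiple-≡[mod] (suc j) (suc j + s)))
    where
      halve : ∀ n j → (j + suc (suc n)) * suc (suc n) + (suc j + suc (suc n)) * suc (suc n)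
                      ≡ suc j + (suc j + suc (suc n)) * (suc n + suc (suc n))
      halve = solve-∀
  offset-step j true = ≡⇒≡[mod] (shift n j)
    where
      shift : ∀ n j → (j + suc (suc n)) * suc (suc n) + suc (suc n) ≡ (suc j + suc (suc n)) * suc (suc n)
      shift = solve-∀

  xor-cancelʳ : ∀ a b → (a xor b) xor b ≡ a
  xor-cancelʳ false false = refl
  xor-cancelʳ false true  = refl
  xor-cancelʳ true  false = refl
  xor-cancelʳ true  true  = refl

  xor-swap : ∀ a δ b → a xor (δ xor b) ≡ δ xor (a xor b)
  xor-swap false δ     b = refl
  xor-swap true  false b = refl
  xor-swap true  true  b = refl

  candidate : ℕ → Colour → Bool → ℕ → Colour
  candidate k (b , r) δ t = δ xor b , r ⊖ (offset k δ + t)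

  candidates : ℕ → Colour → List Colour
  candidates k y = applyDownFrom (candidate k y false) (width k false) ++ applyDownFrom (candidate k y true) (width k true)

  candidate-∈-candidates : ∀ k y δ {t} → t < width k δ → candidate k y δ t ∈ candidates k y
  candidate-∈-candidates k y false t<w = ∈-++⁺ˡ (∈-applyDownFrom⁺ (candidate k y false) t<w)
  candidate-∈-candidates k y true  t<w = ∈-++⁺ʳ _ (∈-applyDownFrom⁺ (candidate k y true) t<w)

  ∈-candidates : ∀ k {x y} → Near k x y → x ∈ candidates k y
  ∈-candidates k {b , r} {b′ , r′} t<w =
    subst (_∈ candidates k (b′ , r′)) (cong₂ _,_ (xor-cancelʳ b b′) residue)
          (candidate-∈-candidates k (b′ , r′) (b xor b′) t<w)
    where
      d = offset k (b xor b′)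
      t = toℕ (r′ ⊖ (toℕ r + d))
      rotate : ∀ a b c → a + (b + c) ≡ c + (a + b)
      rotate = solve-∀
      residue : r′ ⊖ (d + t) ≡ r
      residue = toℕ-injective (⊖-unique (toℕ<n r)
        (≡[mod]-trans (≡⇒≡[mod] (rotate (toℕ r) d t)) (⊖-+-≡[mod] r′ (toℕ r + d))))

  -- Candidates of the two layers at distance less than M₁ (resp. M₂) below v₁ (resp. v₂)
  -- are Near j z, and v₂ + M₁ + 1 ≡ v₁ modulo m; there are always at least j of them.
  module _ (j M₁ M₂ : ℕ) (j≤n : j ≤ n) (j≤M₁ : j ≤ M₁) (j≤M₂ : j ≤ M₂) (M₁+M₂≡j+1+n : M₁ + M₂ ≡ j + suc n) where

    record Blocks (v₁ v₂ : ℕ) : Set where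
      field
        B₁ B₂   : ℕ
        total   : B₁ + B₂ ≡ j
        window₁ : Window (suc j) M₁ v₁ B₁
        window₂ : Window (suc n) M₂ v₂ B₂

    capacity : suc n + M₂ + suc M₁ ≡ j + m
    capacity = begin
      suc n + M₂ + suc M₁      ≡⟨ rearrange (suc n) M₂ M₁ ⟩
      suc n + suc (M₁ + M₂)    ≡⟨ cong (λ t → suc n + suc t) M₁+M₂≡j+1+n ⟩
      suc n + suc (j + suc n)  ≡⟨ spread n j ⟩
      j + m                    ∎
      where
        open ≡-Reasoning
        rearrange : ∀ a b c → a + b + suc c ≡ a + suc (c + b)
        rearrange = solve-∀
        spread : ∀ n j → suc n + suc (j + suc n) ≡ j + (suc n + suc (suc n))
        spread = solve-∀

    M₁≤1+n : M₁ ≤ suc n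
    M₁≤1+n = +-cancelʳ-≤ M₂ M₁ (suc n) (begin
      M₁ + M₂     ≡⟨ M₁+M₂≡j+1+n ⟩
      j + suc n   ≤⟨ +-monoˡ-≤ (suc n) j≤M₂ ⟩
      M₂ + suc n  ≡⟨ +-comm M₂ (suc n) ⟩
      suc n + M₂  ∎)
      where open ≤-Reasoning

    1+x+x<R+M : ∀ {x R M} → x < j → j ≤ R → j ≤ M → suc x + x < R + M
    1+x+x<R+M x<j j≤R j≤M = <-≤-trans (+-mono-≤-< x<j x<j) (+-mono-≤ j≤R j≤M)

    blocks-unwrapped-near : ∀ {v₁ v₂} → v₂ < j → v₂ + suc M₁ ≡ v₁ → Blocks v₁ v₂
    blocks-unwrapped-near {v₁} {v₂} v₂<j v₂+1+M₁≡v₁ with m≤n⇒∃[o]m+o≡n v₂<j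
    ... | d , 1+v₂+d≡j = record
      { B₁ = d ; B₂ = suc v₂
      ; total = trans (+-comm d (suc v₂)) 1+v₂+d≡j
      ; window₁ = window (m≤n⇒m≤1+n d≤j) d≤M₁ (≤-trans d≤M₁ (m≤n⇒m≤1+n M₁≤v₁)) (≤-reflexive (cong suc d+v₁≡j+M₁))
      ; window₂ = window (≤-trans v₂<j (m≤n⇒m≤1+n j≤n)) (≤-trans v₂<j j≤M₂) ≤-refl (1+x+x<R+M v₂<j (m≤n⇒m≤1+n j≤n) j≤M₂)
      }
      where
        d≤j : d ≤ j
        d≤j = subst (d ≤_) 1+v₂+d≡j (m≤n+m d (suc v₂))
        d≤M₁ : d ≤ M₁
        d≤M₁ = ≤-trans d≤j j≤M₁
        M₁≤v₁ : M₁ ≤ v₁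
        M₁≤v₁ = subst (M₁ ≤_) v₂+1+M₁≡v₁ (≤-trans (n≤1+n M₁) (m≤n+m (suc M₁) v₂))
        d+v₁≡j+M₁ : d + v₁ ≡ j + M₁
        d+v₁≡j+M₁ = begin
          d + v₁              ≡⟨ cong (d +_) v₂+1+M₁≡v₁ ⟨
          d + (v₂ + suc M₁)   ≡⟨ regroup d v₂ M₁ ⟩
          suc v₂ + d + M₁     ≡⟨ cong (_+ M₁) 1+v₂+d≡j ⟩
          j + M₁              ∎
          where
            open ≡-Reasoning
            regroup : ∀ d v M → d + (v + suc M) ≡ suc v + d + M
            regroup = solve-∀

    blocks-unwrapped-far : ∀ {v₁ v₂} → j ≤ v₂ → v₁ < m → v₂ + suc M₁ ≡ v₁ → Blocks v₁ v₂
    blocks-unwrapped-far {v₁} {v₂} j≤v₂ v₁<m v₂+1+M₁≡v₁ = record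
      { B₁ = 0 ; B₂ = j
      ; total = refl
      ; window₁ = empty-window
      ; window₂ = window (m≤n⇒m≤1+n j≤n) j≤M₂ (m≤n⇒m≤1+n j≤v₂) (+-cancelʳ-< (suc M₁) (j + v₂) (suc n + M₂) (begin-strict
          j + v₂ + suc M₁        ≡⟨ +-assoc j v₂ (suc M₁) ⟩
          j + (v₂ + suc M₁)      ≡⟨ cong (j +_) v₂+1+M₁≡v₁ ⟩
          j + v₁                 <⟨ +-monoʳ-< j v₁<m ⟩
          j + m                  ≡⟨ capacity ⟨
          suc n + M₂ + suc M₁    ∎))
      }
      where open ≤-Reasoning

    blocks-wrapped-near : ∀ {v₁ v₂} → v₁ < j → v₂ + suc M₁ ≡ v₁ + m → Blocks v₁ v₂
    blocks-wrapped-near {v₁} {v₂} v₁<j v₂+1+M₁≡v₁+m with m≤n⇒∃[o]m+o≡n v₁<j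
    ... | d , 1+v₁+d≡j = record
      { B₁ = suc v₁ ; B₂ = d
      ; total = 1+v₁+d≡j
      ; window₁ = window (≤-trans v₁<j (n≤1+n j)) (≤-trans v₁<j j≤M₁) ≤-refl (1+x+x<R+M v₁<j (n≤1+n j) j≤M₁)
      ; window₂ = window (≤-trans d≤n (n≤1+n n)) (≤-trans d≤j j≤M₂) (≤-trans d≤n (≤-trans (n≤1+n n) (m≤n⇒m≤1+n 1+n≤v₂)))
          (+-cancelʳ-< (suc M₁) (d + v₂) (suc n + M₂) (begin-strict
            d + v₂ + suc M₁     ≡⟨ +-assoc d v₂ (suc M₁) ⟩
            d + (v₂ + suc M₁)   ≡⟨ cong (d +_) v₂+1+M₁≡v₁+m ⟩
            d + (v₁ + m)        ≡⟨ +-assoc d v₁ m ⟨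
            d + v₁ + m          <⟨ +-monoˡ-< m d+v₁<j ⟩
            j + m               ≡⟨ capacity ⟨
            suc n + M₂ + suc M₁ ∎))
      }
      where
        open ≤-Reasoning
        d≤j : d ≤ j
        d≤j = subst (d ≤_) 1+v₁+d≡j (m≤n+m d (suc v₁))
        d≤n : d ≤ n
        d≤n = ≤-trans d≤j j≤n
        d+v₁<j : d + v₁ < j
        d+v₁<j = subst (d + v₁ <_) 1+v₁+d≡j (≤-reflexive (cong suc (+-comm d v₁)))
        1+n≤v₂ : suc n ≤ v₂
        1+n≤v₂ = +-cancelʳ-≤ (suc (suc n)) (suc n) v₂ (begin
          m                    ≤⟨ m≤n+m m v₁ ⟩
          v₁ + m               ≡⟨ v₂+1+M₁≡v₁+m ⟨
          v₂ + suc M₁          ≤⟨ +-monoʳ-≤ v₂ (s≤s M₁≤1+n) ⟩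
          v₂ + suc (suc n)     ∎)

    blocks-wrapped-far : ∀ {v₁ v₂} → j ≤ v₁ → v₂ < m → v₂ + suc M₁ ≡ v₁ + m → Blocks v₁ v₂
    blocks-wrapped-far {v₁} {v₂} j≤v₁ v₂<m v₂+1+M₁≡v₁+m = record
      { B₁ = j ; B₂ = 0
      ; total = +-identityʳ j
      ; window₁ = window (n≤1+n j) j≤M₁ (m≤n⇒m≤1+n j≤v₁) (begin-strict
          j + v₁       <⟨ +-monoʳ-< j v₁<1+M₁ ⟩
          j + suc M₁   ≡⟨ +-suc j M₁ ⟩
          suc j + M₁   ∎)
      ; window₂ = empty-window
      }
      where
        open ≤-Reasoning
        v₁<1+M₁ : v₁ < suc M₁
        v₁<1+M₁ = +-cancelʳ-< m v₁ (suc M₁) (begin-strict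
          v₁ + m        ≡⟨ v₂+1+M₁≡v₁+m ⟨
          v₂ + suc M₁   <⟨ +-monoˡ-< (suc M₁) v₂<m ⟩
          m + suc M₁    ≡⟨ +-comm m (suc M₁) ⟩
          suc M₁ + m    ∎)

    blocks : ∀ {v₁ v₂} → v₁ < m → v₂ < m → v₂ + suc M₁ ≡ v₁ ⊎ v₂ + suc M₁ ≡ v₁ + m → Blocks v₁ v₂
    blocks {v₁} {v₂} v₁<m v₂<m (inj₁ unwrapped) with v₂ <? j
    ... | yes v₂<j = blocks-unwrapped-near v₂<j unwrapped
    ... | no v₂≮j = blocks-unwrapped-far (≮⇒≥ v₂≮j) v₁<m unwrapped
    blocks {v₁} {v₂} v₁<m v₂<m (inj₂ wrapped) with v₁ <? j
    ... | yes v₁<j = blocks-wrapped-near v₁<j wrapped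
    ... | no v₁≮j = blocks-wrapped-far (≮⇒≥ v₁≮j) v₂<m wrapped

  stepList : ℕ → Colour → Colour → List Colour
  stepList j z y = filter (λ x → ¬? (Near? j z x)) (candidates (suc j) y)

  ∈-stepList : ∀ j {z x y} → Near (suc j) x y → ¬ Near j z x → x ∈ stepList j z y
  ∈-stepList j {z} {x} {y} e ¬e = ∈-filter⁺ (λ x → ¬? (Near? j z x)) (∈-candidates (suc j) {x} {y} e) ¬e

  module _ (j : ℕ) (bz : Bool) (rz : Fin m) (by : Bool) (ry : Fin m) where

    private
      z y : Colour
      z = bz , rz
      y = by , ry
      ε = bz xor by
      P? = λ x → ¬? (Near? j z x)

    gap : Bool → Fin m
    gap δ = ry ⊖ (toℕ rz + offset j (δ xor ε) + offset (suc j) δ)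

    Near-candidate : ∀ δ {t e} → t + e ≡ toℕ (gap δ) → e < width j (δ xor ε) → Near j z (candidate (suc j) y δ t)
    Near-candidate δ {t} {e} t+e≡gap e<w rewrite xor-swap bz δ by =
      subst (_< width j (δ xor ε)) (sym (trans (cong toℕ reorder) (⊖-exact t+e≡gap))) e<w
      where
        d = toℕ rz + offset j (δ xor ε)
        d′ = offset (suc j) δ
        reorder : ry ⊖ (d′ + t) ⊖ d ≡ gap δ ⊖ t
        reorder = begin
          ry ⊖ (d′ + t) ⊖ d    ≡⟨ ⊖-⊖ ry (d′ + t) d ⟩
          ry ⊖ (d′ + t + d)    ≡⟨ cong (ry ⊖_) (swap d′ t d) ⟩
          ry ⊖ (d + d′ + t)    ≡⟨ ⊖-⊖ ry (d + d′) t ⟨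
          gap δ ⊖ t            ∎
          where
            open ≡-Reasoning
            swap : ∀ a b c → a + b + c ≡ c + a + b
            swap = solve-∀

    gap-true : gap true ≡ gap false ⊖ suc (width j ε)
    gap-true = begin
      ry ⊖ (toℕ rz + offset j (not ε) + offset (suc j) true)    ≡⟨ cong (ry ⊖_) (+-assoc (toℕ rz) _ _) ⟩
      ry ⊖ (toℕ rz + (offset j (not ε) + offset (suc j) true))  ≡⟨ ⊖-cong ry (+-cong-≡[mod] (≡[mod]-refl {a = toℕ rz}) (offset-step j ε)) ⟨
      ry ⊖ (toℕ rz + (offset j ε + suc (width j ε)))            ≡⟨ cong (ry ⊖_) (+-assoc (toℕ rz) (offset j ε) _) ⟨
      ry ⊖ (toℕ rz + offset j ε + suc (width j ε))              ≡⟨ cong (λ d → ry ⊖ (d + suc (width j ε))) (+-identityʳ _) ⟨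
      ry ⊖ (toℕ rz + offset j ε + 0 + suc (width j ε))          ≡⟨ ⊖-⊖ ry _ (suc (width j ε)) ⟨
      gap false ⊖ suc (width j ε)                               ∎
      where open ≡-Reasoning

    excluded-block : ∀ δ {R B} → Window R (width j (δ xor ε)) (toℕ (gap δ)) B →
                     length (filter P? (applyDownFrom (candidate (suc j) y δ) R)) + B ≤ R
    excluded-block δ w = length-filter-applyDownFrom-gap P? (candidate (suc j) y δ) _ (Window.fits w)
      λ lo≤i i<lo+B ¬e → let (_ , i+e≡v , e<M) = Window.near w lo≤i i<lo+B in ¬e (Near-candidate δ i+e≡v e<M)

    length-stepList : j ≤ n → length (stepList j z y) ≤ s
    length-stepList j≤n = begin
      length (stepList j z y)                              ≡⟨ cong length (filter-++ P? part₁ part₂) ⟩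
      length (filter P? part₁ ++ filter P? part₂)          ≡⟨ length-++ (filter P? part₁) ⟩
      length (filter P? part₁) + length (filter P? part₂)  ≤⟨ combine {length (filter P? part₁)} {length (filter P? part₂)}
                                                                (excluded-block false window₁) (excluded-block true window₂) total ⟩
      s                                                    ∎
      where
        open ≤-Reasoning
        part₁ = applyDownFrom (candidate (suc j) y false) (suc j)
        part₂ = applyDownFrom (candidate (suc j) y true) (suc n)
        M₁ = width j ε
        related : toℕ (gap true) + suc M₁ ≡ toℕ (gap false) ⊎ toℕ (gap true) + suc M₁ ≡ toℕ (gap false) + m
        related rewrite gap-true = toℕ-⊖-cases (gap false) (s≤s (≤-trans (width-≤ ε j≤n) (≤-trans (n≤1+n (suc n)) (m≤n+m s n))))
        bl = blocks j M₁ (width j (not ε)) j≤n (width-≥ ε j≤n) (width-≥ (not ε) j≤n) (width-total j ε)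
               (toℕ<n (gap false)) (toℕ<n (gap true)) related
        open Blocks bl
        combine : ∀ {L₁ L₂ B₁ B₂} → L₁ + B₁ ≤ suc j → L₂ + B₂ ≤ suc n → B₁ + B₂ ≡ j → L₁ + L₂ ≤ s
        combine {L₁} {L₂} {B₁} {B₂} h₁ h₂ B₁+B₂≡j = +-cancelʳ-≤ j (L₁ + L₂) s (begin
          L₁ + L₂ + j            ≡⟨ cong (L₁ + L₂ +_) B₁+B₂≡j ⟨
          L₁ + L₂ + (B₁ + B₂)    ≡⟨ interchange L₁ L₂ B₁ B₂ ⟩
          L₁ + B₁ + (L₂ + B₂)    ≤⟨ +-mono-≤ h₁ h₂ ⟩
          suc j + suc n          ≡⟨ +-comm (suc j) (suc n) ⟩
          suc n + suc j          ≡⟨ cong suc (+-suc n j) ⟩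
          s + j                  ∎)

  -- The layer f xor by, enumerated from the start of the window Near (suc n) z.
  middleCandidates : Bool → Colour → Colour → List Colour
  middleCandidates f (bz , rz) (by , ry) = applyDownFrom (λ t → b , (base + t) mod m) m
    where
      b = f xor by
      base = toℕ rz + offset (suc n) (bz xor b)

  middleList : Bool → Colour → Colour → List Colour
  middleList f z y = filter (λ x → ¬? (Near? (suc n) z x)) (middleCandidates f z y)

  ∈-middleList : ∀ f {z x y} → proj₁ x ≡ f xor proj₁ y → ¬ Near (suc n) z x → x ∈ middleList f z y
  ∈-middleList f {z@(bz , rz)} {bx , rx} {y@(by , ry)} refl ¬e =
    ∈-filter⁺ (λ x → ¬? (Near? (suc n) z x))
      (subst (λ r → (bx , r) ∈ middleCandidates f z y) (⊖-mod rx base)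
        (∈-applyDownFrom⁺ (λ t → bx , (base + t) mod m) (toℕ<n (rx ⊖ base))))
      ¬e
    where base = toℕ rz + offset (suc n) (bz xor bx)

  length-middleList : ∀ f z y → length (middleList f z y) ≤ s
  length-middleList f z@(bz , rz) y@(by , ry) = +-cancelʳ-≤ (suc n) _ s (begin
    length (middleList f z y) + suc n   ≤⟨ length-filter-applyDownFrom-gap (λ x → ¬? (Near? (suc n) z x)) _ m {0} {suc n} (m≤m+n (suc n) s) excluded ⟩
    m                                   ≡⟨ +-comm (suc n) s ⟩
    s + suc n                           ∎)
    where
      open ≤-Reasoning
      b = f xor by
      base = toℕ rz + offset (suc n) (bz xor b)
      excluded : ∀ {t} → 0 ≤ t → t < suc n → ¬ ¬ Near (suc n) z (b , (base + t) mod m)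
      excluded {t} _ t<1+n ¬e = ¬e (subst₂ _<_ (sym (mod-⊖ base (≤-trans t<1+n (m≤m+n (suc n) s)))) (sym (width-last (bz xor b))) t<1+n)

  halfList : Bool → ℕ → Colour → Colour → List Colour
  halfList f zero    z y = candidates 1 y
  halfList f (suc j) z y with suc j ≤? n
  ... | yes _ = stepList (suc j) z y
  ... | no  _ = middleList f z y

  length-halfList : ∀ f i z y → length (halfList f i z y) ≤ s
  length-halfList f zero z y = ≤-reflexive (begin
    length (candidates 1 y)                                ≡⟨ length-++ (applyDownFrom (candidate 1 y false) 1) {applyDownFrom (candidate 1 y true) (suc n)} ⟩
    length (applyDownFrom (candidate 1 y false) 1) + length (applyDownFrom (candidate 1 y true) (suc n))
                                                           ≡⟨ cong (1 +_) (length-applyDownFrom (candidate 1 y true) (suc n)) ⟩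
    s                                                      ∎)
    where open ≡-Reasoning
  length-halfList f (suc j) (bz , rz) (by , ry) with suc j ≤? n
  ... | yes 1+j≤n = length-stepList (suc j) bz rz by ry 1+j≤n
  ... | no  _     = length-middleList f (bz , rz) (by , ry)

  halfCover : ∀ f → ChainCover n (λ i → Near (suc i)) (λ x y → proj₁ x ≡ f xor proj₁ y) (halfList f)
  halfCover f = record
    { cover-first = λ {z} {x} {y} → ∈-candidates 1 {x} {y}
    ; cover-step  = step
    ; cover-last  = last
    }
    where
      step : ∀ {i z x y} → i < n → Near (suc (suc i)) x y → ¬ Near (suc i) z x → x ∈ halfList f (suc i) z y
      step {i} {z} {x} {y} i<n e ¬e with suc i ≤? n
      ... | yes _    = ∈-stepList (suc i) {z} {x} {y} e ¬e
      ... | no 1+i≰n = contradiction i<n 1+i≰n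
      last : ∀ {z x y} → proj₁ x ≡ f xor proj₁ y → ¬ Near (suc n) z x → x ∈ halfList f (suc n) z y
      last {z} {x} {y} q ¬e with suc n ≤? n
      ... | yes 1+n≤n = contradiction 1+n≤n (n≮n n)
      ... | no _      = ∈-middleList f {z} {x} {y} q ¬e

padTo : ∀ {A : Set} → A → List A → (g : ℕ) → Vec A g
padTo a []       g       = replicate g a
padTo a (x ∷ xs) zero    = []ᵥ
padTo a (x ∷ xs) (suc g) = x ∷ᵥ padTo a xs g

∈-padTo : ∀ {A : Set} {x : A} {a xs g} → length xs ≤ g → x ∈ xs → x Vec.∈ padTo a xs g
∈-padTo {xs = _ ∷ _} (s≤s len) (here x≡y)   = VecAny.here x≡y
∈-padTo {xs = _ ∷ _} (s≤s len) (there x∈xs) = VecAny.there (∈-padTo len x∈xs)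

module PathGame (n : ℕ) where
  open Colours n

  V H last : ℕ
  V = 2 * s
  H = 4 * s ∸ 2
  last = pred V

  H≡m+m : H ≡ m + m
  H≡m+m = double n
    where
      double : ∀ n → n + (suc (suc n) + (suc (suc n) + (suc (suc n) + 0))) ≡ suc n + suc (suc n) + (suc n + suc (suc n))
      double = solve-∀

  layer : Bool → Fin m → Fin m ⊎ Fin m
  layer false = inj₁
  layer true  = inj₂

  unlayer : Fin m ⊎ Fin m → Colour
  unlayer = [ (false ,_) , (true ,_) ]′

  layer-unlayer : ∀ i → layer (proj₁ (unlayer i)) (proj₂ (unlayer i)) ≡ i
  layer-unlayer (inj₁ r) = refl
  layer-unlayer (inj₂ r) = refl

  decode : Fin H → Colour
  decode h = unlayer (splitAt m (cast H≡m+m h))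

  encode : Colour → Fin H
  encode (b , r) = cast (sym H≡m+m) (join m m (layer b r))

  encode-decode : ∀ h → encode (decode h) ≡ h
  encode-decode h = begin
    cast (sym H≡m+m) (join m m (layer (proj₁ (unlayer i)) (proj₂ (unlayer i))))  ≡⟨ cong (cast (sym H≡m+m) ∘ join m m) (layer-unlayer i) ⟩
    cast (sym H≡m+m) (join m m (splitAt m (cast H≡m+m h)))                       ≡⟨ cong (cast (sym H≡m+m)) (join-splitAt m m (cast H≡m+m h)) ⟩
    cast (sym H≡m+m) (cast H≡m+m h)                                              ≡⟨ cast-involutive (sym H≡m+m) H≡m+m h ⟩
    h                                                                            ∎
    where
      open ≡-Reasoning
      i = splitAt m (cast H≡m+m h)

  colourAt : HatAssignment {V} (λ _ → H) → ℕ → Colour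
  colourAt c i with i <? V
  ... | yes i<V = decode (c (fromℕ< i<V))
  ... | no  _   = false , fzero

  colourAt-toℕ : ∀ c v → colourAt c (toℕ v) ≡ decode (c v)
  colourAt-toℕ c v with toℕ v <? V
  ... | yes v<V = cong (decode ∘ c) (toℕ-injective (toℕ-fromℕ< v<V))
  ... | no  v≮V = contradiction (toℕ<n v) v≮V

  colourAt-local : ∀ c c′ i → (∀ (i<V : i < V) → c (fromℕ< i<V) ≡ c′ (fromℕ< i<V)) → colourAt c i ≡ colourAt c′ i
  colourAt-local c c′ i agree with i <? V
  ... | yes i<V = cong decode (agree i<V)
  ... | no  _   = refl

  mirror : ℕ → ℕ
  mirror i = last ∸ i

  sageList : ℕ → (ℕ → Colour) → List Colour
  sageList i κ with i <? s
  ... | yes _ = halfList false i (κ (pred i)) (κ (suc i))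
  ... | no  _ = halfList true (mirror i) (κ (suc i)) (κ (pred i))

  length-sageList : ∀ i κ → length (sageList i κ) ≤ s
  length-sageList i κ with i <? s
  ... | yes _ = length-halfList false i (κ (pred i)) (κ (suc i))
  ... | no  _ = length-halfList true (mirror i) (κ (suc i)) (κ (pred i))

  sageList-local : ∀ i κ κ′ → κ (suc i) ≡ κ′ (suc i) → (∀ j → suc j ≡ i → κ j ≡ κ′ j) → sageList i κ ≡ sageList i κ′
  sageList-local zero κ κ′ right _ with 0 <? s
  ... | yes _ = cong (candidates 1) right
  ... | no 0≮s = contradiction z<s 0≮s
  sageList-local (suc i) κ κ′ right left with suc i <? s
  ... | yes _ = cong₂ (halfList false (suc i)) (left i refl) right
  ... | no  _ = cong₂ (halfList true (mirror (suc i))) right (left i refl)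

  sageGuess : (v : Fin V) → HatAssignment {V} (λ _ → H) → Vec (Fin H) s
  sageGuess v c = padTo (encode (false , fzero)) (map encode (sageList (toℕ v) (colourAt c))) s

  sageGuess-local : ∀ v c c′ → (∀ u → Adj (path V) v u → c u ≡ c′ u) → sageGuess v c ≡ sageGuess v c′
  sageGuess-local v c c′ agree =
    cong (λ xs → padTo (encode (false , fzero)) (map encode xs) s) (sageList-local (toℕ v) (colourAt c) (colourAt c′) right left)
    where
      right : colourAt c (suc (toℕ v)) ≡ colourAt c′ (suc (toℕ v))
      right = colourAt-local c c′ _ λ i<V → agree (fromℕ< i<V) (inj₁ (sym (toℕ-fromℕ< i<V)))
      left : ∀ j → suc j ≡ toℕ v → colourAt c j ≡ colourAt c′ j
      left j 1+j≡v = colourAt-local c c′ j λ j<V → agree (fromℕ< j<V) (inj₂ (trans (cong suc (toℕ-fromℕ< j<V)) 1+j≡v))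

  strategy : Strategy (path V) (λ _ → H) (λ _ → s)
  strategy = record { guess = sageGuess ; local = sageGuess-local }

  ∈-sageGuess : ∀ c v → decode (c v) ∈ sageList (toℕ v) (colourAt c) → c v Vec.∈ sageGuess v c
  ∈-sageGuess c v d∈ = ∈-padTo (subst (_≤ s) (sym (length-map encode xs)) (length-sageList (toℕ v) (colourAt c)))
    (subst (_∈ map encode xs) (encode-decode (c v)) (∈-map⁺ encode d∈))
    where xs = sageList (toℕ v) (colourAt c)

  last≡s+1+n : last ≡ s + suc n
  last≡s+1+n = spread n
    where
      spread : ∀ n → suc (n + (suc (suc n) + 0)) ≡ suc (suc n) + suc n
      spread = solve-∀

  <s⇒<last : ∀ {p} → p < s → p < last
  <s⇒<last p<s = <-≤-trans p<s (subst (s ≤_) (sym last≡s+1+n) (m≤m+n s (suc n)))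

  s≤mirror : ∀ {p} → p < s → s ≤ mirror p
  s≤mirror {p} p<s = m+n≤o⇒m≤o∸n s (subst (s + p ≤_) (sym last≡s+1+n) (+-monoʳ-≤ s (s≤s⁻¹ p<s)))

  mirror-involutive : ∀ {p} → p ≤ last → mirror (mirror p) ≡ p
  mirror-involutive = m∸[m∸n]≡n

  mirror-suc : ∀ p → mirror (suc p) ≡ pred (mirror p)
  mirror-suc p = sym (pred[m∸n]≡m∸[1+n] last p)

  suc-mirror-suc : ∀ {p} → suc p ≤ last → suc (mirror (suc p)) ≡ mirror p
  suc-mirror-suc 1+p≤last = sym (+-∸-assoc 1 1+p≤last)

  mirror-middle : mirror (suc n) ≡ s
  mirror-middle = trans (m+n∸m≡n n (s + 0)) (+-identityʳ s)

  mirror-s : mirror s ≡ suc n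
  mirror-s = trans (mirror-suc (suc n)) (cong pred mirror-middle)

  module _ (κ : ℕ → Colour) where

    sageList-left : ∀ {i} → i < s → sageList i κ ≡ halfList false i (κ (pred i)) (κ (suc i))
    sageList-left {i} i<s with i <? s
    ... | yes _   = refl
    ... | no i≮s = contradiction i<s i≮s

    halfList-mirrored : ∀ p y → p < s → halfList true p (κ (suc (mirror p))) y ≡ halfList true p (κ (mirror (pred p))) y
    halfList-mirrored zero    y _     = refl
    halfList-mirrored (suc p) y 1+p<s =
      cong (λ i → halfList true (suc p) (κ i) y) (suc-mirror-suc (<⇒≤ (<s⇒<last 1+p<s)))

    sageList-right : ∀ {p} → p < s → sageList (mirror p) κ ≡ halfList true p (κ (mirror (pred p))) (κ (mirror (suc p)))
    sageList-right {p} p<s with mirror p <? s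
    ... | yes mirror<s = contradiction (s≤mirror p<s) (<⇒≱ mirror<s)
    ... | no _ = begin
      halfList true (mirror (mirror p)) (κ (suc (mirror p))) (κ (pred (mirror p)))  ≡⟨ cong₂ (λ q y → halfList true q (κ (suc (mirror p))) y) (mirror-involutive p≤last) (cong κ (sym (mirror-suc p))) ⟩
      halfList true p (κ (suc (mirror p))) (κ (mirror (suc p)))                      ≡⟨ halfList-mirrored p (κ (mirror (suc p))) p<s ⟩
      halfList true p (κ (mirror (pred p))) (κ (mirror (suc p)))                     ∎
      where
        open ≡-Reasoning
        p≤last : p ≤ last
        p≤last = <⇒≤ (<s⇒<last p<s)

  open import Data.Vec.Membership.DecPropositional (Fin._≟_ {H}) using (_∈?_)

  someone-wins : ∀ c → ¬ ¬ ∃ λ v → c v Vec.∈ sageGuess v c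
  someone-wins c nobody = contradiction (¬-not (left-excluded ∘ sym)) right-excluded
    where
      κ = colourAt c

      miss : ∀ {i} → i < V → κ i ∉ sageList i κ
      miss {i} i<V κi∈ = nobody (v , ∈-sageGuess c v (subst (_∈ sageList (toℕ v) κ) (colourAt-toℕ c v) κv∈))
        where
          v = fromℕ< i<V
          κv∈ : κ (toℕ v) ∈ sageList (toℕ v) κ
          κv∈ = subst (λ j → κ j ∈ sageList j κ) (sym (toℕ-fromℕ< i<V)) κi∈

      left-excluded : proj₁ (κ (suc n)) ≢ proj₁ (κ s)
      left-excluded = ChainCover.excluded-last (halfCover false) κ λ i i≤1+n →
        subst (κ i ∉_) (sageList-left κ (s≤s i≤1+n)) (miss (≤-trans (s≤s i≤1+n) (m≤m+n s (s + 0))))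

      right-excluded : proj₁ (κ s) ≢ not (proj₁ (κ (suc n)))
      right-excluded = subst₂ (λ i j → proj₁ (κ i) ≢ not (proj₁ (κ j))) mirror-middle mirror-s
        (ChainCover.excluded-last (halfCover true) (κ ∘ mirror) λ p p≤1+n →
          subst (κ (mirror p) ∉_) (sageList-right κ (s≤s p≤1+n)) (miss (s≤s (m∸n≤m last p))))

  wins : Wins strategy
  wins c = decidable-stable (any? λ v → c v ∈? sageGuess v c) (someone-wins c)

pairGuess : (v : Fin 2) → HatAssignment {2} (λ _ → 2) → Vec (Fin 2) 1
pairGuess 0F c = c 1F ∷ᵥ []ᵥ
pairGuess 1F c = opposite (c 0F) ∷ᵥ []ᵥ

pairGuess-local : ∀ v c c′ → (∀ u → Adj (path 2) v u → c u ≡ c′ u) → pairGuess v c ≡ pairGuess v c′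
pairGuess-local 0F c c′ agree = cong (_∷ᵥ []ᵥ) (agree 1F (inj₁ refl))
pairGuess-local 1F c c′ agree = cong (λ h → opposite h ∷ᵥ []ᵥ) (agree 0F (inj₂ refl))

pairStrategy : Strategy (path 2) (λ _ → 2) (λ _ → 1)
pairStrategy = record { guess = pairGuess ; local = pairGuess-local }

pairWins : Wins pairStrategy
pairWins c with c 0F in e₀ | c 1F in e₁
... | 0F | 0F = 0F , VecAny.here (trans e₀ (sym e₁))
... | 1F | 1F = 0F , VecAny.here (trans e₀ (sym e₁))
... | 0F | 1F = 1F , VecAny.here (trans e₁ (cong opposite (sym e₀)))
... | 1F | 0F = 1F , VecAny.here (trans e₁ (cong opposite (sym e₀)))

corollary3p2 : (s : ℕ) → 1 ≤ s →
    Winning (path (2 * s)) (λ _ → 4 * s ∸ 2) (λ _ → s)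
corollary3p2 1 _ = pairStrategy , pairWins
corollary3p2 (suc (suc n)) _ = PathGame.strategy n , PathGame.wins n
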